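{- Let $M=([n],\mathcal{F})$ be a $\Delta$-matroid and let $r_M:2^{[n]}\to\mathbb{Z}_{\ge0}$ be its rank function. Then the function $\{0,1\}^n\to\mathbb{R}$, $e_S\mapsto -r_M(S)$, is a valuated $\Delta$-matroid.
   Context: A $\Delta$-matroid on $[n]$ is a family $\mathcal{F}$ of subsets of $[n]$ (bases) such that whenever $A,B\in\mathcal{F}$ and $a\in A\Delta B$, there exists $b\in A\Delta B$ with $A\Delta\{a,b\}\in\mathcal{F}$. Its rank function is $r_M(S)=\max_{B\in\mathcal{F}}(|B\cap S|+|B^C\cap S^C|)$, where $T^C=[n]\setminus T$. $e_S=\sum_{i\in S}e_i$. For $p:\{0,1\}^n\to\mathbb{R}\cup\{\infty\}$ let $\operatorname{dom}p=\{y:p(y)\neq\infty\}$, $P_p=\operatorname{conv}\{(y,p(y)):y\in\operatorname{dom}p\}$, and let the induced subdivision $\mathcal{S}_p$ be the set of projections (deleting last coordinate) of lower faces of $P_p$ (faces supported by hyperplanes with inner normal having positive last coordinate). Length of a segment between $0/1$-points is the Hamming distance of its endpoints. $p$ is a valuated $\Delta$-matroid if every edge of $\mathcal{S}_p$ has length at most $2$. -}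

module Defs where

open import Data.Nat as ℕ using (ℕ; _+_)
open import Data.Bool using (Bool; true; false; _xor_; if_then_else_)
open import Data.Fin using (Fin)
open import Data.Fin.Subset using (Subset; _∈_; _∩_; _∪_; ∁; ∣_∣; ⁅_⁆)
open import Data.Vec using (Vec; zipWith; lookup)
open import Data.List using (List; foldr; map; allFin)
open import Data.Integer using (+_)
open import Data.Rational as ℚ using (ℚ; 0ℚ; _/_)
open import Data.Maybe using (Maybe; just; nothing)
open import Data.Product using (Σ; ∃; ∃-syntax; _×_)
open import Data.Sum using (_⊎_)
open import Relation.Binary.PropositionalEquality using (_≡_; _≢_)

-- Subsets of [n] are identified with 0/1-vectors: S ↦ e_S.

_Δ_ : ∀ {n} → Subset n → Subset n → Subset n
A Δ B = zipWith _xor_ A B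

IsDeltaMatroid : ∀ {n} → (Subset n → Set) → Set
IsDeltaMatroid {n} F =
  ∀ A B → F A → F B → ∀ a → a ∈ (A Δ B) →
    ∃[ b ] (b ∈ (A Δ B) × F (A Δ (⁅ a ⁆ ∪ ⁅ b ⁆)))

rankTerm : ∀ {n} → Subset n → Subset n → ℕ
rankTerm B S = ∣ B ∩ S ∣ + ∣ ∁ B ∩ ∁ S ∣

IsRankFunction : ∀ {n} → (Subset n → Set) → (Subset n → ℕ) → Set
IsRankFunction F r =
  ∀ S → (∃[ B ] (F B × r S ≡ rankTerm B S))
      × (∀ B → F B → rankTerm B S ℕ.≤ r S)

dot : ∀ {n} → (Fin n → ℚ) → Subset n → ℚ
dot {n} w S = foldr ℚ._+_ 0ℚ (map (λ i → if lookup S i then w i else 0ℚ) (allFin n))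

-- A function {0,1}^n → ℚ ∪ {∞}; nothing = ∞.
-- y is a point of P_p minimizing the functional (w , c) · (y , p y).
IsMinimizer : ∀ {n} → (Subset n → Maybe ℚ) → (Fin n → ℚ) → ℚ → Subset n → Set
IsMinimizer p w c y =
  ∃[ v ] (p y ≡ just v ×
    (∀ z v' → p z ≡ just v' → dot w y ℚ.+ c ℚ.* v ℚ.≤ dot w z ℚ.+ c ℚ.* v'))

-- {y , z} is an edge of the induced subdivision S_p: the projection of the
-- lower face of P_p cut out by a supporting hyperplane with inner normal
-- (w , c), c > 0, is the segment conv{y , z} (y ≠ z), i.e. the lattice points
-- of dom p lifted onto that face are exactly y and z.
IsEdge : ∀ {n} → (Subset n → Maybe ℚ) → Subset n → Subset n → Set
IsEdge {n} p y z =
  Σ (Fin n → ℚ) λ w → Σ ℚ λ c →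
    (0ℚ ℚ.< c) × (y ≢ z) × IsMinimizer p w c y × IsMinimizer p w c z ×
    (∀ x → IsMinimizer p w c x → (x ≡ y) ⊎ (x ≡ z))

IsValuatedDeltaMatroid : ∀ {n} → (Subset n → Maybe ℚ) → Set
IsValuatedDeltaMatroid p = ∀ y z → IsEdge p y z → ∣ y Δ z ∣ ℕ.≤ 2

negRank : ∀ {n} → (Subset n → ℕ) → Subset n → Maybe ℚ
negRank r S = just (ℚ.- ((+ r S) / 1))

-- Let (w, c), c > 0, be the inner normal of a lower face of P_p with minimum m
-- of w·e_S − c·r(S). As r(S) is a maximum over bases, this objective is the
-- minimum over bases B of a coordinatewise sum Σᵢ κᵢ(Bᵢ, Sᵢ), and the face
-- consists of the points S with a basis B attaining m (a tight pair (B, S)).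
-- Let (By, y), (Bz, z) be tight with |y Δ z| ≥ 3. Overriding the coordinates in
-- T of one pair by those of the other preserves the total of the two sums, so
-- if one overridden basis lies in F the other overridden pair has sum ≤ m.
-- Two applications of the exchange axiom give T = {u, v} ⊆ By Δ Bz for which
-- the pair overridden from (By, y) is tight. Since |T| ≤ 2 its point differs
-- from z; either it differs from y too, a third point of the face, or its basis
-- is closer to Bz and we recurse. Once By = Bz, overriding y at a single
-- coordinate of y Δ z gives the third point.
module Submission where

open import Defs
open import Data.Nat as ℕ using (ℕ; zero; suc; z≤n; s≤s)
import Data.Nat.Properties as ℕ
open import Data.Nat.Induction using (<-wellFounded; Acc; acc)
open import Data.Nat.Coprimality using (1-coprimeTo) renaming (sym to coprime-sym)
open import Data.Integer as ℤ using (+_)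
import Data.Integer.Properties as ℤ
open import Data.Rational as ℚ using (ℚ; mkℚ; 0ℚ; _/_; _+_; _*_; -_; _≤_; _<_)
import Data.Rational.Properties as ℚ
open import Algebra.Bundles using (CommutativeMonoid)
open import Algebra.Properties.CommutativeSemigroup
  (CommutativeMonoid.commutativeSemigroup ℚ.+-0-commutativeMonoid) using (interchange)
open import Data.Bool using (Bool; true; false; not; _xor_; if_then_else_)
import Data.Bool.Properties as Bool
open import Data.Fin using (Fin; zero; suc; _≟_)
open import Data.Fin.Subset
  using (Subset; _∈_; _∉_; _∩_; _∪_; _⊆_; _⊂_; ∣_∣; ⁅_⁆; Nonempty; Empty)
open import Data.Fin.Subset.Properties
  using ( _∈?_; nonempty?; drop-∷-Empty; Empty-unique; ∣⊥∣≡0; ∣⁅x⁆∣≡1; x∈⁅x⁆; x∈⁅y⁆⇒x≡y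
        ; x∈p∩q⁻; x∈p∪q⁻; x∈p∪q⁺; ∪-idem; p⊆q⇒∣p∣≤∣q∣; p⊂q⇒∣p∣<∣q∣)
open import Data.Vec using ([]; _∷_; here; there; lookup)
open import Data.Vec.Properties using (lookup-zipWith; []=⇒lookup; lookup⇒[]=; ≡-dec)
open import Data.Vec.Relation.Binary.Pointwise.Extensional using (ext; Pointwise-≡⇒≡)
open import Data.List using (foldr)
open import Data.List.Properties using (map-tabulate)
open import Data.Product using (∃-syntax; _×_; _,_; proj₁; proj₂)
open import Data.Sum using (inj₁; inj₂; [_,_]′)
open import Function using (_∘_)
open import Relation.Nullary using (Dec; yes; no; contradiction)
open import Relation.Binary.PropositionalEquality

private
  variable
    n : ℕ
    i u v : Fin n
    p T X Y B B' S S' : Subset n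

pair : Fin n → Fin n → Subset n
pair u v = ⁅ u ⁆ ∪ ⁅ v ⁆

u∈pair : u ∈ pair u v
u∈pair {u = u} = x∈p∪q⁺ (inj₁ (x∈⁅x⁆ u))

pair⊆ : u ∈ p → v ∈ p → pair u v ⊆ p
pair⊆ {u = u} {v = v} u∈p v∈p i∈ with x∈p∪q⁻ ⁅ u ⁆ ⁅ v ⁆ i∈
... | inj₁ i∈⁅u⁆ rewrite x∈⁅y⁆⇒x≡y u i∈⁅u⁆ = u∈p
... | inj₂ i∈⁅v⁆ rewrite x∈⁅y⁆⇒x≡y v i∈⁅v⁆ = v∈p

⁅u⁆∩⁅v⁆-empty : u ≢ v → Empty (⁅ u ⁆ ∩ ⁅ v ⁆)
⁅u⁆∩⁅v⁆-empty {u = u} {v = v} u≢v (i , i∈) =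
  let i∈⁅u⁆ , i∈⁅v⁆ = x∈p∩q⁻ ⁅ u ⁆ ⁅ v ⁆ i∈
  in u≢v (trans (sym (x∈⁅y⁆⇒x≡y u i∈⁅u⁆)) (x∈⁅y⁆⇒x≡y v i∈⁅v⁆))

∣p∪q∣≤∣p∣+∣q∣ : (p q : Subset n) → ∣ p ∪ q ∣ ℕ.≤ ∣ p ∣ ℕ.+ ∣ q ∣
∣p∪q∣≤∣p∣+∣q∣ []          []          = z≤n
∣p∪q∣≤∣p∣+∣q∣ (true ∷ p)  (true ∷ q)  = s≤s (ℕ.≤-trans (∣p∪q∣≤∣p∣+∣q∣ p q) (ℕ.+-monoʳ-≤ ∣ p ∣ (ℕ.n≤1+n _)))
∣p∪q∣≤∣p∣+∣q∣ (true ∷ p)  (false ∷ q) = s≤s (∣p∪q∣≤∣p∣+∣q∣ p q)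
∣p∪q∣≤∣p∣+∣q∣ (false ∷ p) (true ∷ q)  = ℕ.≤-trans (s≤s (∣p∪q∣≤∣p∣+∣q∣ p q)) (ℕ.≤-reflexive (sym (ℕ.+-suc ∣ p ∣ ∣ q ∣)))
∣p∪q∣≤∣p∣+∣q∣ (false ∷ p) (false ∷ q) = ∣p∪q∣≤∣p∣+∣q∣ p q

∣pair∣≤2 : (u v : Fin n) → ∣ pair u v ∣ ℕ.≤ 2
∣pair∣≤2 u v = ℕ.≤-trans (∣p∪q∣≤∣p∣+∣q∣ ⁅ u ⁆ ⁅ v ⁆) (ℕ.≤-reflexive (cong₂ ℕ._+_ (∣⁅x⁆∣≡1 u) (∣⁅x⁆∣≡1 v)))

∣p∣>0⇒nonempty : 0 ℕ.< ∣ p ∣ → Nonempty p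
∣p∣>0⇒nonempty {n} {p} 0<∣p∣ with nonempty? p
... | yes ne = ne
... | no  e  = contradiction (trans (cong ∣_∣ (Empty-unique e)) (∣⊥∣≡0 n)) (ℕ.>⇒≢ 0<∣p∣)

∈Δ⇒≢ : i ∈ X Δ Y → lookup X i ≢ lookup Y i
∈Δ⇒≢ {i = i} {X} {Y} i∈ Xi≡Yi = contradiction (begin
  false                     ≡⟨ sym (Bool.xor-same (lookup X i)) ⟩
  lookup X i xor lookup X i ≡⟨ cong (lookup X i xor_) Xi≡Yi ⟩
  lookup X i xor lookup Y i ≡⟨ lookup-zipWith _xor_ i X Y ⟨
  lookup (X Δ Y) i          ≡⟨ []=⇒lookup i∈ ⟩
  true                      ∎) λ ()
  where open ≡-Reasoning

≢⇒∈Δ : lookup X i ≢ lookup Y i → i ∈ X Δ Y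
≢⇒∈Δ {X = X} {i} {Y} Xi≢Yi = lookup⇒[]= i (X Δ Y) (begin
  lookup (X Δ Y) i                ≡⟨ lookup-zipWith _xor_ i X Y ⟩
  lookup X i xor lookup Y i       ≡⟨ cong (_xor lookup Y i) (Bool.¬-not Xi≢Yi) ⟩
  not (lookup Y i) xor lookup Y i ≡⟨ Bool.xor-inverseˡ (lookup Y i) ⟩
  true                            ∎)
  where open ≡-Reasoning

∈Δ-comm : i ∈ X Δ Y → i ∈ Y Δ X
∈Δ-comm = ≢⇒∈Δ ∘ ≢-sym ∘ ∈Δ⇒≢

Δ-empty⇒≡ : Empty (X Δ Y) → X ≡ Y
Δ-empty⇒≡ {X = X} {Y} empty = Pointwise-≡⇒≡ (ext pointwise)
  where
  pointwise : ∀ i → lookup X i ≡ lookup Y i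
  pointwise i with lookup X i Bool.≟ lookup Y i
  ... | yes eq = eq
  ... | no  ne = contradiction (i , ≢⇒∈Δ ne) empty

override : Subset n → Subset n → Subset n → Subset n
override []      []      []      = []
override (t ∷ T) (x ∷ X) (y ∷ Y) = (if t then y else x) ∷ override T X Y

lookup-override-∈ : i ∈ T → lookup (override T X Y) i ≡ lookup Y i
lookup-override-∈ {T = _ ∷ _} {_ ∷ _} {_ ∷ _} here        = refl
lookup-override-∈ {T = _ ∷ _} {_ ∷ _} {_ ∷ _} (there i∈T) = lookup-override-∈ i∈T

lookup-override-∉ : i ∉ T → lookup (override T X Y) i ≡ lookup X i
lookup-override-∉ {i = zero}  {true ∷ _}                  i∉T = contradiction here i∉T
lookup-override-∉ {i = zero}  {false ∷ _} {_ ∷ _} {_ ∷ _} i∉T = refl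
lookup-override-∉ {i = suc i} {_ ∷ _}     {_ ∷ _} {_ ∷ _} i∉T = lookup-override-∉ (i∉T ∘ there)

override-same : (T X : Subset n) → override T X X ≡ X
override-same []          []      = refl
override-same (true ∷ T)  (x ∷ X) = cong (x ∷_) (override-same T X)
override-same (false ∷ T) (x ∷ X) = cong (x ∷_) (override-same T X)

Δ-override : T ⊆ X Δ Y → X Δ T ≡ override T X Y
Δ-override {T = T} {X} {Y} T⊆XΔY = Pointwise-≡⇒≡ (ext λ i →
  trans (lookup-zipWith _xor_ i X T) (pointwise i (i ∈? T)))
  where
  pointwise : ∀ i → Dec (i ∈ T) → lookup X i xor lookup T i ≡ lookup (override T X Y) i
  pointwise i (yes i∈T) = begin
    lookup X i xor lookup T i ≡⟨ cong (lookup X i xor_) ([]=⇒lookup i∈T) ⟩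
    lookup X i xor true       ≡⟨ Bool.xor-comm (lookup X i) true ⟩
    not (lookup X i)          ≡⟨ Bool.¬-not (∈Δ⇒≢ (T⊆XΔY i∈T) ∘ sym) ⟨
    lookup Y i                ≡⟨ lookup-override-∈ i∈T ⟨
    lookup (override T X Y) i ∎
    where open ≡-Reasoning
  pointwise i (no i∉T) = begin
    lookup X i xor lookup T i ≡⟨ cong (lookup X i xor_) (Bool.¬-not (i∉T ∘ lookup⇒[]= i T)) ⟩
    lookup X i xor false      ≡⟨ Bool.xor-identityʳ (lookup X i) ⟩
    lookup X i                ≡⟨ lookup-override-∉ i∉T ⟨
    lookup (override T X Y) i ∎
    where open ≡-Reasoning

override-≢ˡ : i ∈ T → i ∈ X Δ Y → override T X Y ≢ X
override-≢ˡ {i = i} i∈T i∈XΔY O≡X =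
  ∈Δ⇒≢ i∈XΔY (trans (cong (λ V → lookup V i) (sym O≡X)) (lookup-override-∈ i∈T))

override-≢ʳ : ∣ T ∣ ℕ.< ∣ X Δ Y ∣ → override T X Y ≢ Y
override-≢ʳ {T = T} {X} {Y} ∣T∣<∣XΔY∣ O≡Y = ℕ.<⇒≱ ∣T∣<∣XΔY∣ (p⊆q⇒∣p∣≤∣q∣ XΔY⊆T)
  where
  XΔY⊆T : X Δ Y ⊆ T
  XΔY⊆T {i} i∈XΔY with i ∈? T
  ... | yes i∈T = i∈T
  ... | no  i∉T = contradiction
    (trans (sym (lookup-override-∉ i∉T)) (cong (λ V → lookup V i) O≡Y)) (∈Δ⇒≢ i∈XΔY)

Δ-override-⊂ : i ∈ T → i ∈ X Δ Y → override T X Y Δ Y ⊂ X Δ Y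
Δ-override-⊂ {i = i} {T} {X} {Y} i∈T i∈XΔY =
  shrinks , i , i∈XΔY , λ i∈OΔY → ∈Δ⇒≢ i∈OΔY (lookup-override-∈ i∈T)
  where
  shrinks : override T X Y Δ Y ⊆ X Δ Y
  shrinks {j} j∈OΔY with j ∈? T
  ... | yes j∈T = contradiction (lookup-override-∈ j∈T) (∈Δ⇒≢ j∈OΔY)
  ... | no  j∉T = ≢⇒∈Δ (subst (_≢ lookup Y j) (lookup-override-∉ j∉T) (∈Δ⇒≢ j∈OΔY))

coordSum : (Fin n → Bool → Bool → ℚ) → Subset n → Subset n → ℚ
coordSum κ []      []      = 0ℚ
coordSum κ (b ∷ B) (s ∷ S) = κ zero b s + coordSum (κ ∘ suc) B S

private
  module _ (a b : ℚ) {x y x' y' : ℚ} (tails : x + y ≡ x' + y') where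
    heads-fixed : (a + x) + (b + y) ≡ (a + x') + (b + y')
    heads-fixed = trans (interchange a x b y) (trans (cong (_+_ (a + b)) tails) (sym (interchange a x' b y')))

    heads-swapped : (a + x) + (b + y) ≡ (b + x') + (a + y')
    heads-swapped = trans (interchange a x b y)
      (trans (cong₂ _+_ (ℚ.+-comm a b) tails) (sym (interchange b x' a y')))

coordSum-override-swap : ∀ κ (T B B' S S' : Subset n) →
  coordSum κ (override T B B') (override T S S') + coordSum κ (override T B' B) (override T S' S)
    ≡ coordSum κ B S + coordSum κ B' S'
coordSum-override-swap κ [] [] [] [] [] = refl
coordSum-override-swap κ (true ∷ T) (b ∷ B) (b' ∷ B') (s ∷ S) (s' ∷ S') =
  heads-swapped (κ zero b' s') (κ zero b s) (coordSum-override-swap (κ ∘ suc) T B B' S S')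
coordSum-override-swap κ (false ∷ T) (b ∷ B) (b' ∷ B') (s ∷ S) (s' ∷ S') =
  heads-fixed (κ zero b s) (κ zero b' s') (coordSum-override-swap (κ ∘ suc) T B B' S S')

coordSum-override-∪ : ∀ κ (T U B B' S S' : Subset n) → Empty (T ∩ U) →
  coordSum κ (override (T ∪ U) B B') (override (T ∪ U) S S') + coordSum κ B S
    ≡ coordSum κ (override T B B') (override T S S') + coordSum κ (override U B B') (override U S S')
coordSum-override-∪ κ [] [] [] [] [] [] _ = refl
coordSum-override-∪ κ (true ∷ T) (true ∷ U) _ _ _ _ empty = contradiction (zero , here) empty
coordSum-override-∪ κ (true ∷ T) (false ∷ U) (b ∷ B) (b' ∷ B') (s ∷ S) (s' ∷ S') empty =
  heads-fixed (κ zero b' s') (κ zero b s) (coordSum-override-∪ (κ ∘ suc) T U B B' S S' (drop-∷-Empty empty))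
coordSum-override-∪ κ (false ∷ T) (true ∷ U) (b ∷ B) (b' ∷ B') (s ∷ S) (s' ∷ S') empty =
  heads-swapped (κ zero b' s') (κ zero b s) (coordSum-override-∪ (κ ∘ suc) T U B B' S S' (drop-∷-Empty empty))
coordSum-override-∪ κ (false ∷ T) (false ∷ U) (b ∷ B) (b' ∷ B') (s ∷ S) (s' ∷ S') empty =
  heads-fixed (κ zero b s) (κ zero b s) (coordSum-override-∪ (κ ∘ suc) T U B B' S S' (drop-∷-Empty empty))

x+y≤m+m⇒m≤y⇒x≤m : ∀ {x y m} → x + y ≤ m + m → m ≤ y → x ≤ m
x+y≤m+m⇒m≤y⇒x≤m x+y≤m+m m≤y =
  ℚ.≮⇒≥ λ m<x → ℚ.<-irrefl refl (ℚ.<-≤-trans (ℚ.+-mono-<-≤ m<x m≤y) x+y≤m+m)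

x+x≤m+m⇒x≤m : ∀ {x m} → x + x ≤ m + m → x ≤ m
x+x≤m+m⇒x≤m x+x≤m+m = ℚ.≮⇒≥ λ m<x → ℚ.<-irrefl refl (ℚ.<-≤-trans (ℚ.+-mono-< m<x m<x) x+x≤m+m)

argmax : (f : Fin n → ℚ) (p : Subset n) → Nonempty p → ∃[ a ] a ∈ p × (∀ {i} → i ∈ p → f i ≤ f a)
argmax f (s ∷ p) _ with nonempty? p
argmax f (s ∷ p) (zero , here)      | no ¬p =
  zero , here , λ { here → ℚ.≤-refl ; (there j∈) → contradiction (_ , j∈) ¬p }
argmax f (s ∷ p) (suc j , there j∈) | no ¬p = contradiction (j , j∈) ¬p
argmax f (s ∷ p) _                  | yes ne with argmax (f ∘ suc) p ne
argmax f (false ∷ p) _ | yes _ | a , a∈ , max = suc a , there a∈ , λ { (there i∈) → max i∈ }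
argmax f (true ∷ p)  _ | yes _ | a , a∈ , max with ℚ.≤-total (f zero) (f (suc a))
... | inj₁ f0≤fa = suc a , there a∈ , λ { here → f0≤fa ; (there i∈) → max i∈ }
... | inj₂ fa≤f0 = zero , here , λ { here → ℚ.≤-refl ; (there i∈) → ℚ.≤-trans (max i∈) fa≤f0 }

-- Exchange in a Δ-matroid against a separable objective

module Exchange {F : Subset n → Set} (isΔ : IsDeltaMatroid F)
                (κ : Fin n → Bool → Bool → ℚ) (m : ℚ)
                (m≤coordSum : ∀ {B} S → F B → m ≤ coordSum κ B S) where

  Tight : Subset n → Subset n → Set
  Tight B S = F B × coordSum κ B S ≤ m

  coordSum-override-≤ : Tight B S → Tight B' S' → F (override T B' B) →
                        coordSum κ (override T B B') (override T S S') ≤ m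
  coordSum-override-≤ {B} {S} {B'} {S'} {T} (_ , BS≤m) (_ , B'S'≤m) F[T:B'←B] =
    x+y≤m+m⇒m≤y⇒x≤m
      (ℚ.≤-trans (ℚ.≤-reflexive (coordSum-override-swap κ T B B' S S')) (ℚ.+-mono-≤ BS≤m B'S'≤m))
      (m≤coordSum _ F[T:B'←B])

  tight-common-basis : Tight B S → Tight B S' → (T : Subset n) → Tight B (override T S S')
  tight-common-basis {B} tight-S tight-S' T = proj₁ tight-S ,
    subst (λ B'' → coordSum κ B'' _ ≤ m) (override-same T B)
      (coordSum-override-≤ tight-S tight-S' (subst F (sym (override-same T B)) (proj₁ tight-S)))

  module _ {By y Bz z} (tight-y : Tight By y) (tight-z : Tight Bz z) where

    swapValue : Subset n → ℚ
    swapValue T = coordSum κ (override T By Bz) (override T y z)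

    gain : Fin n → ℚ
    gain i = swapValue ⁅ i ⁆

    gain+gain≤ : ∀ u v → swapValue (pair u v) ≤ m → gain u + gain v ≤ m + m
    gain+gain≤ u v pair≤m with u ≟ v
    ... | yes refl = ℚ.+-mono-≤ u≤m u≤m
      where u≤m = subst (_≤ m) (cong swapValue (∪-idem ⁅ u ⁆)) pair≤m
    ... | no  u≢v = ℚ.≤-trans
      (ℚ.≤-reflexive (sym (coordSum-override-∪ κ ⁅ u ⁆ ⁅ v ⁆ By Bz y z (⁅u⁆∩⁅v⁆-empty u≢v))))
      (ℚ.+-mono-≤ pair≤m (proj₂ tight-y))

    swapValue≤ : ∀ u v → gain u + gain v ≤ m + m → swapValue (pair u v) ≤ m
    swapValue≤ u v gains≤ with u ≟ v
    ... | yes refl = subst (_≤ m) (cong swapValue (sym (∪-idem ⁅ u ⁆))) (x+x≤m+m⇒x≤m gains≤)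
    ... | no  u≢v = x+y≤m+m⇒m≤y⇒x≤m
      (ℚ.≤-trans (ℚ.≤-reflexive (coordSum-override-∪ κ ⁅ u ⁆ ⁅ v ⁆ By Bz y z (⁅u⁆∩⁅v⁆-empty u≢v))) gains≤)
      (m≤coordSum y (proj₁ tight-y))

    tight-pair : u ∈ By Δ Bz → v ∈ By Δ Bz → F (By Δ pair u v) → gain u + gain v ≤ m + m →
                 Tight (override (pair u v) By Bz) (override (pair u v) y z)
    tight-pair {u} {v} u∈ v∈ F[By] gains≤ = subst F (Δ-override (pair⊆ u∈ v∈)) F[By] , swapValue≤ u v gains≤

    -- Exchanging Bz towards By at a maximiser a of gain gives b with
    -- gain a + gain b ≤ m + m; exchanging By towards Bz at b gives c, and
    -- gain c ≤ gain a.
    improving-pair : Nonempty (By Δ Bz) →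
      ∃[ u ] ∃[ v ] u ∈ By Δ Bz × Tight (override (pair u v) By Bz) (override (pair u v) y z)
    improving-pair ne with argmax gain (By Δ Bz) ne
    ... | a , a∈ , max with isΔ Bz By (proj₁ tight-z) (proj₁ tight-y) a (∈Δ-comm a∈)
    ... | b , b∈' , F[Bz] with isΔ By Bz (proj₁ tight-y) (proj₁ tight-z) b (∈Δ-comm b∈')
    ... | c , c∈ , F[By] = b , c , ∈Δ-comm b∈' , tight-pair (∈Δ-comm b∈') c∈ F[By] (begin
      gain b + gain c ≤⟨ ℚ.+-monoʳ-≤ (gain b) (max c∈) ⟩
      gain b + gain a ≡⟨ ℚ.+-comm (gain b) (gain a) ⟩
      gain a + gain b ≤⟨ gain+gain≤ a b (coordSum-override-≤ tight-y tight-z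
                           (subst F (Δ-override (pair⊆ (∈Δ-comm a∈) b∈')) F[Bz])) ⟩
      m + m           ∎)
      where open ℚ.≤-Reasoning

  third-tight-point : ∀ {By y Bz z} → 2 ℕ.< ∣ y Δ z ∣ → Tight By y → Tight Bz z →
                      ∃[ B ] ∃[ x ] Tight B x × x ≢ y × x ≢ z
  third-tight-point {By} {y} {Bz} {z} 2<∣yΔz∣ tight-y tight-z =
    descend tight-y (<-wellFounded ∣ By Δ Bz ∣)
    where
    descend : ∀ {B} → Tight B y → Acc ℕ._<_ ∣ B Δ Bz ∣ → ∃[ B ] ∃[ x ] Tight B x × x ≢ y × x ≢ z
    descend {B} tight-B (acc smaller) with nonempty? (B Δ Bz)
    ... | no empty with Δ-empty⇒≡ empty
    ...   | refl = let a , a∈ = ∣p∣>0⇒nonempty (ℕ.<-trans (s≤s z≤n) 2<∣yΔz∣) in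
      B , override (pair a a) y z , tight-common-basis tight-B tight-z (pair a a) ,
      override-≢ˡ u∈pair a∈ , override-≢ʳ (ℕ.≤-<-trans (∣pair∣≤2 a a) 2<∣yΔz∣)
    descend {B} tight-B (acc smaller) | yes ne with improving-pair tight-B tight-z ne
    ... | u , v , u∈ , tight-x with ≡-dec Bool._≟_ (override (pair u v) y z) y
    ...   | no  x≢y = _ , _ , tight-x , x≢y , override-≢ʳ (ℕ.≤-<-trans (∣pair∣≤2 u v) 2<∣yΔz∣)
    ...   | yes x≡y = descend (subst (Tight _) x≡y tight-x)
                              (smaller (p⊂q⇒∣p∣<∣q∣ (Δ-override-⊂ u∈pair u∈)))

-- The objective of negRank as a coordinatewise sum

ℕ/1≡mkℚ : ∀ k → + k / 1 ≡ mkℚ (+ k) 0 (coprime-sym (1-coprimeTo k))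
ℕ/1≡mkℚ k = ℚ.normalize-coprime (coprime-sym (1-coprimeTo k))

ℕ/1-+ : ∀ a b → + (a ℕ.+ b) / 1 ≡ + a / 1 + + b / 1
ℕ/1-+ a b rewrite ℕ/1≡mkℚ a | ℕ/1≡mkℚ b =
  cong (_/ 1) (trans (ℤ.pos-+ a b) (sym (cong₂ ℤ._+_ (ℤ.*-identityʳ (+ a)) (ℤ.*-identityʳ (+ b)))))

ℕ/1-mono-≤ : ∀ {a b} → a ℕ.≤ b → + a / 1 ≤ + b / 1
ℕ/1-mono-≤ {a} {b} a≤b rewrite ℕ/1≡mkℚ a | ℕ/1≡mkℚ b =
  ℚ.*≤* (subst₂ ℤ._≤_ (sym (ℤ.*-identityʳ (+ a))) (sym (ℤ.*-identityʳ (+ b))) (ℤ.+≤+ a≤b))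

agree : Bool → Bool → ℕ
agree true  true  = 1
agree false false = 1
agree true  false = 0
agree false true  = 0

rankTerm-∷ : ∀ b s (B S : Subset n) → rankTerm (b ∷ B) (s ∷ S) ≡ agree b s ℕ.+ rankTerm B S
rankTerm-∷ true  true  B S = refl
rankTerm-∷ true  false B S = refl
rankTerm-∷ false true  B S = refl
rankTerm-∷ false false B S = ℕ.+-suc ∣ B ∩ S ∣ _

dot-∷ : ∀ (w : Fin (suc n) → ℚ) s S →
        dot w (s ∷ S) ≡ (if s then w zero else 0ℚ) + dot (w ∘ suc) S
dot-∷ {n} w s S = cong (_+_ (if s then w zero else 0ℚ)) (cong (foldr _+_ 0ℚ)
  (trans (map-tabulate suc term) (sym (map-tabulate (λ i → i) (term ∘ suc)))))
  where
  term : Fin (suc n) → ℚ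
  term i = if lookup (s ∷ S) i then w i else 0ℚ

objective : (Fin n → ℚ) → ℚ → Fin n → Bool → Bool → ℚ
objective w c i b s = (if s then w i else 0ℚ) + c * - (+ agree b s / 1)

coordSum-objective : ∀ w c (B S : Subset n) →
                     coordSum (objective w c) B S ≡ dot w S + c * - (+ rankTerm B S / 1)
coordSum-objective w c []      []      = sym (trans (ℚ.+-identityˡ _) (ℚ.*-zeroʳ c))
coordSum-objective w c (b ∷ B) (s ∷ S) = begin
  (h + c * - e) + coordSum (objective (w ∘ suc) c) B S
    ≡⟨ cong (_+_ (h + c * - e)) (coordSum-objective (w ∘ suc) c B S) ⟩
  (h + c * - e) + (d + c * - r)
    ≡⟨ interchange h _ d _ ⟩
  (h + d) + (c * - e + c * - r)
    ≡⟨ cong (_+_ (h + d)) (ℚ.*-distribˡ-+ c (- e) (- r)) ⟨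
  (h + d) + c * (- e + - r)
    ≡⟨ cong (λ t → (h + d) + c * t) (ℚ.neg-distrib-+ e r) ⟨
  (h + d) + c * - (e + r)
    ≡⟨ cong (λ t → (h + d) + c * - t) (ℕ/1-+ (agree b s) _) ⟨
  (h + d) + c * - (+ (agree b s ℕ.+ rankTerm B S) / 1)
    ≡⟨ cong₂ (λ t k → t + c * - (+ k / 1)) (dot-∷ w s S) (rankTerm-∷ b s B S) ⟨
  dot w (s ∷ S) + c * - (+ rankTerm (b ∷ B) (s ∷ S) / 1) ∎
  where
  open ≡-Reasoning
  h = if s then w zero else 0ℚ
  d = dot (w ∘ suc) S
  e = + agree b s / 1
  r = + rankTerm B S / 1

module NegRank {F : Subset n → Set} {r : Subset n → ℕ} (isRank : IsRankFunction F r)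
               (w : Fin n → ℚ) (c : ℚ) (0<c : 0ℚ < c) where

  value : Subset n → ℚ
  value S = dot w S + c * - (+ r S / 1)

  minimizer⇒minimal : ∀ {x} → IsMinimizer (negRank r) w c x → ∀ S → value x ≤ value S
  minimizer⇒minimal (_ , refl , minimal) S = minimal S _ refl

  minimal⇒minimizer : ∀ {x} → (∀ S → value x ≤ value S) → IsMinimizer (negRank r) w c x
  minimal⇒minimizer minimal = _ , refl , λ { S _ refl → minimal S }

  value≤coordSum : F B → value S ≤ coordSum (objective w c) B S
  value≤coordSum {B} {S} FB = subst (value S ≤_) (sym (coordSum-objective w c B S))
    (ℚ.+-monoʳ-≤ (dot w S) (ℚ.*-monoˡ-≤-nonNeg c {{ℚ.nonNegative (ℚ.<⇒≤ 0<c)}}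
      (ℚ.neg-antimono-≤ (ℕ/1-mono-≤ (proj₂ (isRank S) B FB)))))

  coordSum≡value : ∀ S → ∃[ B ] F B × coordSum (objective w c) B S ≡ value S
  coordSum≡value S = let B , FB , rS≡ = proj₁ (isRank S) in
    B , FB , trans (coordSum-objective w c B S) (cong (λ k → dot w S + c * - (+ k / 1)) (sym rS≡))

theorem4p3 : (n : ℕ) (F : Subset n → Set) → IsDeltaMatroid F →
    (r : Subset n → ℕ) → IsRankFunction F r →
    IsValuatedDeltaMatroid (negRank r)
theorem4p3 n F isΔ r isRank y z (w , c , 0<c , _ , y-min , z-min , only-y-z) =
  ℕ.≮⇒≥ λ 2<∣yΔz∣ →
    let _ , tight-y = tight y ℚ.≤-refl
        _ , tight-z = tight z (minimal z-min y)
        _ , x , (FB , x≤m) , x≢y , x≢z = third-tight-point 2<∣yΔz∣ tight-y tight-z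
    in [ x≢y , x≢z ]′ (only-y-z x (minimal⇒minimizer λ S →
         ℚ.≤-trans (ℚ.≤-trans (value≤coordSum FB) x≤m) (minimal y-min S)))
  where
  open NegRank isRank w c 0<c renaming (minimizer⇒minimal to minimal)
  open Exchange isΔ (objective w c) (value y) (λ S FB → ℚ.≤-trans (minimal y-min S) (value≤coordSum FB))

  tight : ∀ S → value S ≤ value y → ∃[ B ] Tight B S
  tight S S≤y = let B , FB , eq = coordSum≡value S in B , FB , ℚ.≤-trans (ℚ.≤-reflexive eq) S≤y
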